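{- Let $q$ be a prime power, $n$ a positive integer, and $m \geq 3$ an integer with $m \le n+2$. Let $A \subseteq \mathbb{F}_q^n$ be an $m$-general set. Then for every integer $k$ with $1 \leq k \leq \lfloor m/2 \rfloor$, $A$ is a weak $B_k$ set in the additive group $\mathbb{F}_q^n$.
   Context: A set $A \subseteq \mathbb{F}_q^n$ with $|A| \ge m$ is called $m$-general (for $3 \le m \le n+2$) if no $m$ points of $A$ lie on a single $(m-2)$-dimensional affine subspace (flat) of $\mathbb{F}_q^n$; equivalently, every $m$-element subset of $A$ is affinely independent. A set of points is affinely dependent if there is a linear combination $\sum_j c_j \mathbf{a}_j = \mathbf{0}$ with $\sum_j c_j = 0$ and the $c_j$ not all zero. For an abelian group $G$ and positive integer $k$, a subset $A \subseteq G$ is a weak $B_k$ set if the only solutions of $a_1+\cdots+a_k = b_1+\cdots+b_k$ with $a_1,\dots,a_k$ distinct elements of $A$ and $b_1,\dots,b_k$ distinct elements of $A$ are those where $(a_1,\dots,a_k)$ is a permutation of $(b_1,\dots,b_k)$. -}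

module Defs where

open import Level using (Level; _⊔_)
open import Data.Nat using (ℕ; zero; suc; _≤_; _^_)
open import Data.Nat.Primality using (Prime)
open import Data.Fin using (Fin; zero; suc)
open import Data.Product using (Σ; ∃; _×_; _,_)
open import Relation.Nullary using (¬_)
open import Relation.Binary.PropositionalEquality using (_≡_)
open import Algebra.Bundles using (CommutativeRing)

record IsField {c ℓ : Level} (R : CommutativeRing c ℓ) : Set (c ⊔ ℓ) where
  open CommutativeRing R hiding (zero)
  field
    1≉0     : ¬ (1# ≈ 0#)
    inverse : ∀ x → ¬ (x ≈ 0#) → Σ Carrier λ y → (x * y) ≈ 1#

HasCard : {c ℓ : Level} (R : CommutativeRing c ℓ) → ℕ → Set (c ⊔ ℓ)
HasCard R q = Σ (Fin q → Carrier) λ f →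
    (∀ i j → f i ≈ f j → i ≡ j) × (∀ x → ∃ λ i → f i ≈ x)
  where open CommutativeRing R

IsPrimePower : ℕ → Set
IsPrimePower q = Σ ℕ λ p → Σ ℕ λ e → Prime p × 1 ≤ e × q ≡ p ^ e

InjectiveFin : ∀ {a b} → (Fin a → Fin b) → Set
InjectiveFin s = ∀ i j → s i ≡ s j → i ≡ j

module Over {c ℓ : Level} (R : CommutativeRing c ℓ) where
  open CommutativeRing R hiding (zero)

  sumR : ∀ {k} → (Fin k → Carrier) → Carrier
  sumR {zero}  f = 0#
  sumR {suc k} f = f zero + sumR (λ i → f (suc i))

  Vect : ℕ → Set c
  Vect n = Fin n → Carrier

  _≈ᵥ_ : ∀ {n} → Vect n → Vect n → Set ℓ
  u ≈ᵥ v = ∀ t → u t ≈ v t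

  0ᵥ : ∀ {n} → Vect n
  0ᵥ t = 0#

  linComb : ∀ {n k} → (Fin k → Carrier) → (Fin k → Vect n) → Vect n
  linComb cs vs t = sumR (λ i → cs i * vs i t)

  sumV : ∀ {n k} → (Fin k → Vect n) → Vect n
  sumV vs t = sumR (λ i → vs i t)

  AffinelyIndependent : ∀ {n k} → (Fin k → Vect n) → Set (c ⊔ ℓ)
  AffinelyIndependent {n} {k} vs =
    ∀ (cs : Fin k → Carrier) → linComb cs vs ≈ᵥ 0ᵥ → sumR cs ≈ 0# → ∀ i → cs i ≈ 0#

  -- A set A = {a_0,…,a_{N-1}} ⊆ F^n of N distinct points (a injective).
  DistinctPoints : ∀ {n N} → (Fin N → Vect n) → Set ℓ
  DistinctPoints {N = N} a = ∀ (i j : Fin N) → a i ≈ᵥ a j → i ≡ j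

  MGeneral : ∀ {n N} → ℕ → (Fin N → Vect n) → Set (c ⊔ ℓ)
  MGeneral {N = N} m a =
    m ≤ N × (∀ (s : Fin m → Fin N) → InjectiveFin s → AffinelyIndependent (λ i → a (s i)))

  WeakB : ∀ {n N} → ℕ → (Fin N → Vect n) → Set ℓ
  WeakB {N = N} k a =
    ∀ (α β : Fin k → Fin N) → InjectiveFin α → InjectiveFin β →
      sumV (λ i → a (α i)) ≈ᵥ sumV (λ i → a (β i)) →
      Σ (Fin k → Fin k) λ π → InjectiveFin π × (∀ i → α i ≡ β (π i))

module Submission where

-- Let a be a family of N points of Fⁿ (F a nontrivial commutative
-- ring) such that any 2k distinct points of a are affinely independent.  If
-- a(α₁)+…+a(αₖ) = a(β₁)+…+a(βₖ) for injective index maps α, β, then: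
--   * if α and β are disjoint, Σ a(αᵢ) − Σ a(βⱼ) = 0 is an affine dependence
--     (coefficients +1 and −1, summing to 0) among 2k distinct points, which is
--     impossible as soon as k ≥ 1;
--   * otherwise αᵢ = βⱼ for some i, j; cancelling that summand leaves two equal
--     sums of k−1 distinct points, which match by induction on k.
-- Hence α is a rearrangement of β, i.e. a is a weak B_k set.

open import Defs
open import Level using (Level)
open import Data.Nat using (ℕ; _≤_; _+_; _/_)
open import Data.Fin using (Fin)
open import Algebra.Bundles using (CommutativeRing)

open import Level using (_⊔_)
import Data.Nat as ℕ
open import Data.Nat using (zero; suc; _<_; _≤′_; ≤′-refl; ≤′-step)
open import Data.Nat.Properties
  using (≤-trans; ≤-reflexive; n≤1+n; +-mono-≤; *-monoˡ-≤; *-comm; +-identityʳ; ≤⇒≤′)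
open import Data.Nat.DivMod using (m/n*n≤m)
open import Data.Fin using (zero; suc; splitAt; join; punchIn; punchOut; _≟_)
open import Data.Fin.Properties
  using (pigeonhole; <⇒≢; ¬∀⟶∃¬; any?; join-splitAt; punchIn-injective; punchIn-punchOut)
open import Data.Vec.Functional using (_∷_)
open import Data.Product using (Σ; ∃; _,_; proj₁; proj₂)
open import Data.Empty using (⊥-elim)
open import Data.Sum using (_⊎_; inj₁; inj₂; [_,_]′; map₁)
open import Function using (_∘_)
open import Relation.Nullary using (¬_; yes; no)
open import Relation.Binary.PropositionalEquality
  using (_≡_; _≢_; refl; sym; trans; cong; module ≡-Reasoning)

Matching : ∀ {a} {A : Set a} {k} → (Fin k → A) → (Fin k → A) → Set a
Matching {k = k} α β = Σ (Fin k → Fin k) λ π → ∀ x → α x ≡ β (π x)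

matching-injective : ∀ {a} {A : Set a} {k} (α β : Fin k → A) →
  (∀ i j → α i ≡ α j → i ≡ j) → ((π , _) : Matching α β) → InjectiveFin π
matching-injective α β α-inj (π , αβπ) x y πx≡πy =
  α-inj x y (trans (αβπ x) (trans (cong β πx≡πy) (sym (αβπ y))))

extend-matching : ∀ {a} {A : Set a} {k} (α β : Fin (suc k) → A) (i j : Fin (suc k)) →
  α i ≡ β j → Matching (α ∘ punchIn i) (β ∘ punchIn j) → Matching α β
extend-matching α β i j αi≡βj (π′ , match′) = proj₁ ∘ image , proj₂ ∘ image
  where
    image : ∀ x → Σ (Fin (suc _)) λ y → α x ≡ β y
    image x with x ≟ i
    ... | yes refl = j , αi≡βj
    ... | no x≢i   = punchIn j (π′ (punchOut i≢x)) ,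
                     trans (cong α (sym (punchIn-punchOut i≢x))) (match′ _)
      where i≢x = λ i≡x → x≢i (sym i≡x)

missed-index : ∀ {r M} (s : Fin r → Fin M) → r < M → ∃ λ e → ∀ i → s i ≢ e
missed-index {r} {M} s r<M
  with ¬∀⟶∃¬ M (λ e → ∃ λ i → s i ≡ e) (λ e → any? (λ i → s i ≟ e)) not-surjective
  where
    not-surjective : ¬ (∀ e → ∃ λ i → s i ≡ e)
    not-surjective surj with pigeonhole r<M (proj₁ ∘ surj)
    ... | i , j , i<j , same = <⇒≢ i<j
            (trans (sym (proj₂ (surj i))) (trans (cong s same) (proj₂ (surj j))))
... | e , unhit = e , λ i sᵢ≡e → unhit (i , sᵢ≡e)

cons-injective : ∀ {r M} (e : Fin M) (s : Fin r → Fin M) → InjectiveFin s →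
  (∀ i → s i ≢ e) → InjectiveFin (e ∷ s)
cons-injective e s s-inj fresh zero    zero    _  = refl
cons-injective e s s-inj fresh zero    (suc y) eq = ⊥-elim (fresh y (sym eq))
cons-injective e s s-inj fresh (suc x) zero    eq = ⊥-elim (fresh x eq)
cons-injective e s s-inj fresh (suc x) (suc y) eq = cong suc (s-inj x y eq)

concat-injective : ∀ {p q M} (α : Fin p → Fin M) (β : Fin q → Fin M) →
  InjectiveFin α → InjectiveFin β → (∀ i j → α i ≢ β j) →
  InjectiveFin ([ α , β ]′ ∘ splitAt p)
concat-injective {p} {q} α β α-inj β-inj disjoint x y eq = begin
  x                           ≡⟨ sym (join-splitAt p q x) ⟩
  join p q (splitAt p x)      ≡⟨ cong (join p q) (copair-injective (splitAt p x) (splitAt p y) eq) ⟩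
  join p q (splitAt p y)      ≡⟨ join-splitAt p q y ⟩
  y                           ∎
  where
    open ≡-Reasoning
    copair-injective : ∀ u v → [ α , β ]′ u ≡ [ α , β ]′ v → u ≡ v
    copair-injective (inj₁ i) (inj₁ j) e = cong inj₁ (α-inj i j e)
    copair-injective (inj₂ i) (inj₂ j) e = cong inj₂ (β-inj i j e)
    copair-injective (inj₁ i) (inj₂ j) e = ⊥-elim (disjoint i j e)
    copair-injective (inj₂ i) (inj₁ j) e = ⊥-elim (disjoint j i (sym e))

-- The geometric part works over any commutative ring F; only the disjoint
-- case uses nontriviality 1 ≉ 0 (no inverses are needed).
module _ {c ℓ : Level} (F : CommutativeRing c ℓ) where
  open CommutativeRing F
    hiding (zero)
    renaming (_+_ to _⊕_; refl to ≈-refl; sym to ≈-sym; trans to ≈-trans; reflexive to ≈-reflexive)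
  open Over F
  open import Relation.Binary.Reasoning.Setoid setoid
  open import Algebra.Properties.Ring ring using (-1*x≈-x)
  open import Algebra.Properties.AbelianGroup +-abelianGroup using (⁻¹-∙-comm)
  open import Algebra.Properties.Group +-group using (ε⁻¹≈ε; ∙-cancelˡ)

  sumR-cong : ∀ {k} {f g : Fin k → Carrier} → (∀ i → f i ≈ g i) → sumR f ≈ sumR g
  sumR-cong {zero}  f≈g = ≈-refl
  sumR-cong {suc k} f≈g = +-cong (f≈g zero) (sumR-cong (f≈g ∘ suc))

  sumR-neg : ∀ {k} (f : Fin k → Carrier) → sumR (λ i → - f i) ≈ - sumR f
  sumR-neg {zero}  f = ≈-sym ε⁻¹≈ε
  sumR-neg {suc k} f = ≈-trans (+-cong ≈-refl (sumR-neg (f ∘ suc))) (⁻¹-∙-comm _ _)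

  sumR-splitAt : ∀ {p q} (h : Fin p ⊎ Fin q → Carrier) →
    sumR (h ∘ splitAt p) ≈ sumR (h ∘ inj₁) ⊕ sumR (h ∘ inj₂)
  sumR-splitAt {zero}  h = ≈-sym (+-identityˡ _)
  sumR-splitAt {suc p} h = begin
    h (inj₁ zero) ⊕ sumR (h′ ∘ splitAt p)                 ≈⟨ +-cong ≈-refl (sumR-splitAt h′) ⟩
    h (inj₁ zero) ⊕ (sumR (h′ ∘ inj₁) ⊕ sumR (h ∘ inj₂))  ≈⟨ ≈-sym (+-assoc _ _ _) ⟩
    sumR (h ∘ inj₁) ⊕ sumR (h ∘ inj₂)                     ∎
    where h′ = λ s → h (map₁ suc s)

  sumR-extract : ∀ {k} (f : Fin (suc k) → Carrier) (i : Fin (suc k)) →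
    sumR f ≈ f i ⊕ sumR (f ∘ punchIn i)
  sumR-extract f zero = ≈-refl
  sumR-extract {suc k} f (suc i) = begin
    f zero ⊕ sumR (f ∘ suc)           ≈⟨ +-cong ≈-refl (sumR-extract (f ∘ suc) i) ⟩
    f zero ⊕ (f (suc i) ⊕ rest)       ≈⟨ ≈-sym (+-assoc _ _ _) ⟩
    (f zero ⊕ f (suc i)) ⊕ rest       ≈⟨ +-cong (+-comm _ _) ≈-refl ⟩
    (f (suc i) ⊕ f zero) ⊕ rest       ≈⟨ +-assoc _ _ _ ⟩
    f (suc i) ⊕ (f zero ⊕ rest)       ∎
    where rest = sumR (f ∘ suc ∘ punchIn i)

  cancel-common : ∀ {n k} (u w : Fin (suc k) → Vect n) (i j : Fin (suc k)) →
    u i ≈ᵥ w j → sumV u ≈ᵥ sumV w → sumV (u ∘ punchIn i) ≈ᵥ sumV (w ∘ punchIn j)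
  cancel-common u w i j uᵢ≈wⱼ Σu≈Σw t = ∙-cancelˡ (u i t) _ _ (begin
    u i t ⊕ sumR (λ x → u (punchIn i x) t)  ≈⟨ ≈-sym (sumR-extract (λ x → u x t) i) ⟩
    sumR (λ x → u x t)                      ≈⟨ Σu≈Σw t ⟩
    sumR (λ x → w x t)                      ≈⟨ sumR-extract (λ x → w x t) j ⟩
    w j t ⊕ sumR (λ x → w (punchIn j x) t)  ≈⟨ +-cong (≈-sym (uᵢ≈wⱼ t)) ≈-refl ⟩
    u i t ⊕ sumR (λ x → w (punchIn j x) t)  ∎)

  IndependentSubsets : ∀ {n N} → ℕ → (Fin N → Vect n) → Set (c ⊔ ℓ)
  IndependentSubsets {N = N} r a =
    ∀ (s : Fin r → Fin N) → InjectiveFin s → AffinelyIndependent (a ∘ s)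

  -- Dropping a point preserves affine independence (give it coefficient 0).
  independent-tail : ∀ {n k} (v : Vect n) (vs : Fin k → Vect n) →
    AffinelyIndependent (v ∷ vs) → AffinelyIndependent vs
  independent-tail v vs ind cs Σcv≈0 Σc≈0 i = ind (0# ∷ cs) padded-comb padded-sum (suc i)
    where
      padded-comb : linComb (0# ∷ cs) (v ∷ vs) ≈ᵥ 0ᵥ
      padded-comb t = ≈-trans (+-cong (zeroˡ (v t)) (Σcv≈0 t)) (+-identityˡ 0#)
      padded-sum : sumR (0# ∷ cs) ≈ 0#
      padded-sum = ≈-trans (+-cong ≈-refl Σc≈0) (+-identityˡ 0#)

  independent-step : ∀ {n N r} (a : Fin N → Vect n) → suc r ≤ N →
    IndependentSubsets (suc r) a → IndependentSubsets r a
  independent-step a r<N ind s s-inj with missed-index s r<N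
  ... | e , fresh = independent-tail (a e) (a ∘ s) (ind (e ∷ s) (cons-injective e s s-inj fresh))

  independent-downward : ∀ {n N r m} (a : Fin N → Vect n) → r ≤′ m → m ≤ N →
    IndependentSubsets m a → IndependentSubsets r a
  independent-downward a ≤′-refl          m≤N ind = ind
  independent-downward a (≤′-step r≤′m)  m≤N ind =
    independent-downward a r≤′m (≤-trans (n≤1+n _) m≤N) (independent-step a m≤N ind)

  disjoint-sums-differ : ∀ {n N k} (a : Fin N → Vect n) → ¬ (1# ≈ 0#) →
    IndependentSubsets (suc k + suc k) a →
    (α β : Fin (suc k) → Fin N) → InjectiveFin α → InjectiveFin β → (∀ i j → α i ≢ β j) →
    ¬ (sumV (a ∘ α) ≈ᵥ sumV (a ∘ β))
  disjoint-sums-differ {N = N} {k = k} a 1≉0 ind α β α-inj β-inj disjoint Σα≈Σβ =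
    1≉0 (ind γ (concat-injective α β α-inj β-inj disjoint) coeffs dependence coeffs-sum zero)
    where
      K = suc k
      γ : Fin (K + K) → Fin N
      γ = [ α , β ]′ ∘ splitAt K
      sign : Fin K ⊎ Fin K → Carrier
      sign = [ (λ _ → 1#) , (λ _ → - 1#) ]′
      coeffs : Fin (K + K) → Carrier
      coeffs = sign ∘ splitAt K
      ones = sumR (λ (_ : Fin K) → 1#)
      coeffs-sum : sumR coeffs ≈ 0#
      coeffs-sum = begin
        sumR coeffs                            ≈⟨ sumR-splitAt sign ⟩
        ones ⊕ sumR (λ (_ : Fin K) → - 1#)     ≈⟨ +-cong ≈-refl (sumR-neg (λ (_ : Fin K) → 1#)) ⟩
        ones ⊕ - ones                          ≈⟨ -‿inverseʳ ones ⟩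
        0#                                     ∎
      dependence : linComb coeffs (a ∘ γ) ≈ᵥ 0ᵥ
      dependence t = begin
        sumR (λ x → coeffs x * a (γ x) t)
          ≈⟨ sumR-splitAt (λ s → sign s * a ([ α , β ]′ s) t) ⟩
        sumR (λ i → 1# * a (α i) t) ⊕ sumR (λ j → - 1# * a (β j) t)
          ≈⟨ +-cong (sumR-cong (λ i → *-identityˡ (a (α i) t))) (sumR-cong (λ j → -1*x≈-x (a (β j) t))) ⟩
        sumR (λ i → a (α i) t) ⊕ sumR (λ j → - a (β j) t)
          ≈⟨ +-cong (Σα≈Σβ t) (sumR-neg (λ j → a (β j) t)) ⟩
        sumR (λ j → a (β j) t) ⊕ - sumR (λ j → a (β j) t)
          ≈⟨ -‿inverseʳ _ ⟩
        0# ∎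

  equal-sums-match : ∀ {n N} k (a : Fin N → Vect n) → ¬ (1# ≈ 0#) →
    k + k ≤ N → IndependentSubsets (k + k) a →
    (α β : Fin k → Fin N) → InjectiveFin α → InjectiveFin β →
    sumV (a ∘ α) ≈ᵥ sumV (a ∘ β) → Matching α β
  equal-sums-match zero a 1≉0 _ _ α β _ _ _ = (λ ()) , (λ ())
  equal-sums-match (suc k) a 1≉0 2k≤N ind α β α-inj β-inj Σα≈Σβ
    with any? (λ i → any? (λ j → α i ≟ β j))
  ... | no no-common = ⊥-elim
          (disjoint-sums-differ a 1≉0 ind α β α-inj β-inj (λ i j αᵢ≡βⱼ → no-common (i , j , αᵢ≡βⱼ)) Σα≈Σβ)
  ... | yes (i , j , αᵢ≡βⱼ) = extend-matching α β i j αᵢ≡βⱼ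
          (equal-sums-match k a 1≉0 2k′≤N (independent-downward a (≤⇒≤′ 2k′≤2k) 2k≤N ind)
            (α ∘ punchIn i) (β ∘ punchIn j)
            (λ x y eq → punchIn-injective i x y (α-inj _ _ eq))
            (λ x y eq → punchIn-injective j x y (β-inj _ _ eq))
            (cancel-common (a ∘ α) (a ∘ β) i j (λ t → ≈-reflexive (cong (λ p → a p t) αᵢ≡βⱼ)) Σα≈Σβ))
    where
      2k′≤2k = +-mono-≤ (n≤1+n k) (n≤1+n k)
      2k′≤N  = ≤-trans 2k′≤2k 2k≤N

double-≤-of-≤-half : ∀ k m → k ≤ m / 2 → k + k ≤ m
double-≤-of-≤-half k m k≤m/2 = ≤-trans (≤-reflexive k+k≡k*2) (≤-trans (*-monoˡ-≤ 2 k≤m/2) (m/n*n≤m m 2))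
  where
    k+k≡k*2 : k + k ≡ k ℕ.* 2
    k+k≡k*2 = trans (cong (k +_) (sym (+-identityʳ k))) (*-comm 2 k)

proposition2p2 : {c ℓ : Level} (F : CommutativeRing c ℓ) → IsField F →
    (q : ℕ) → IsPrimePower q → HasCard F q →
    (n m : ℕ) → 1 ≤ n → 3 ≤ m → m ≤ n + 2 →
    (N : ℕ) (a : Fin N → Over.Vect F n) → Over.DistinctPoints F a →
    Over.MGeneral F m a →
    (k : ℕ) → 1 ≤ k → k ≤ m / 2 → Over.WeakB F k a
proposition2p2 F F-field _ _ _ n m _ _ _ N a _ (m≤N , m-general) k _ k≤m/2 α β α-inj β-inj Σα≈Σβ =
  proj₁ match , matching-injective α β α-inj match , proj₂ match
  where
    2k≤m = double-≤-of-≤-half k m k≤m/2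
    2k-general = independent-downward F a (≤⇒≤′ 2k≤m) m≤N m-general
    match = equal-sums-match F k a (IsField.1≉0 F-field) (≤-trans 2k≤m m≤N) 2k-general
              α β α-inj β-inj Σα≈Σβ
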